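{- Let $n$ be a positive integer and let $P_n=\langle a_0,\dots,a_k\rangle$ be the $n$-th $P$-sequence. Then $\sum_{i=0}^k a_i i^s=0$ for every $s\in\{0,\dots,n-1\}$, and $\sum_{i=0}^k a_i i^n\neq 0$.
   Context: Convention: $0^0=1$. $P$-sequences are finite sequences of integers defined recursively: $\langle 1,-1\rangle$ is a $P$-sequence; if $\langle a_0,\dots,a_k\rangle$ is a $P$-sequence with $a_0=-a_k$, then $\langle a_0,\dots,a_k,a_k,\dots,a_0\rangle$ (the sequence followed by its reversal) is a $P$-sequence; if $\langle a_0,\dots,a_k\rangle$ is a $P$-sequence with $a_0=a_k$, then $\langle a_0,\dots,a_{k-1},0,-a_{k-1},\dots,-a_0\rangle$ is a $P$-sequence; and every $P$-sequence arises by finitely many applications of these clauses. Ordering $P$-sequences by increasing length, $P_n$ denotes the $n$-th one; e.g. $P_1=\langle 1,-1\rangle$, $P_2=\langle 1,-1,-1,1\rangle$, $P_3=\langle 1,-1,-1,0,1,1,-1\rangle$. -}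

module Defs where

open import Data.Nat as ℕ using (ℕ; suc)
open import Data.Integer using (ℤ; +_; -_; _*_; _+_; 0ℤ; 1ℤ; -1ℤ)
open import Data.List using (List; []; _∷_; _∷ʳ_; _++_; reverse; map; length; foldr; zipWith; upTo)
open import Data.List.Membership.Propositional using (_∈_)
open import Data.List.Relation.Unary.All using (All)
open import Data.List.Relation.Unary.Unique.Propositional using (Unique)
open import Data.Product using (Σ; _×_; ∃)
open import Relation.Binary.PropositionalEquality using (_≡_)

-- P-sequences, as the inductive definition in the paper.
-- Every P-sequence has length ≥ 2, so we write a sequence ⟨a₀,…,a_k⟩
-- as  a₀ ∷ (m ∷ʳ a_k)  with m = ⟨a₁,…,a_{k-1}⟩.
data IsP : List ℤ → Set where
  base : IsP (1ℤ ∷ -1ℤ ∷ [])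
  dbl  : ∀ {a m b} → IsP (a ∷ (m ∷ʳ b)) → a ≡ - b →
         IsP ((a ∷ (m ∷ʳ b)) ++ reverse (a ∷ (m ∷ʳ b)))
  flip : ∀ {a m b} → IsP (a ∷ (m ∷ʳ b)) → a ≡ b →
         IsP ((a ∷ m) ++ (0ℤ ∷ map -_ (reverse (a ∷ m))))

-- "s is the n-th P-sequence in order of increasing length":
-- s is a P-sequence and there are exactly n - 1 (distinct) P-sequences
-- of length strictly smaller than that of s.
IsNthP : ℕ → List ℤ → Set
IsNthP n s =
  IsP s ×
  Σ (List (List ℤ)) λ L →
    (suc (length L) ≡ n) ×
    Unique L ×
    All (λ t → IsP t × length t ℕ.< length s) L ×
    (∀ t → IsP t → length t ℕ.< length s → t ∈ L)

-- Σ_{i=0}^{k} a_i i^s  (ℕ exponentiation, so 0^0 = 1)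
moment : ℕ → List ℤ → ℤ
moment s as = foldr _+_ 0ℤ (zipWith (λ i a → a * (+ (i ℕ.^ s))) (upTo (length as)) as)

{-# OPTIONS --safe #-}
module Submission where

-- The P-sequences form a single chain: every P-sequence starts with 1 and ends with -1 or 1,
-- and its last entry decides which of the two rules applies, so the n-th P-sequence is the
-- (n-1)-fold extension of ⟨1,-1⟩, and lengths grow strictly along the chain.
--
-- The middle of a sequence ending in -1 is antisymmetric and that of a sequence ending in 1
-- is symmetric. Hence, as a polynomial Σ aᵢ xⁱ, each rule multiplies the sequence by 1 - x^L
-- for some L ≥ 1, and P_n is a product of n such factors: it has a zero of order exactly n at
-- x = 1. Over ℤ this reads: if the n-th forward difference of φ is a constant c, then
-- Σ aᵢ φ(i) = c · K with K ≠ 0 (K = ±∏ L). The function i ↦ i^s has constant s-th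
-- difference s!, so its n-th difference is 0 for s < n and n! for s = n.

open import Defs
open import Data.Nat as ℕ using (ℕ; zero; suc; _<_; _≥_; z<s; s<s; s≤s; _^_; _!)
import Data.Nat.Properties as ℕ
open import Data.Integer using (ℤ; +_; -_; _+_; _-_; _*_; 0ℤ; 1ℤ; -1ℤ)
import Data.Integer.Properties as ℤ
open import Data.Integer.Tactic.RingSolver using (solve-∀)
open import Data.List
  using (List; []; _∷_; _∷ʳ_; _++_; [_]; reverse; map; length; foldr; zipWith; applyUpTo; upTo)
open import Data.List.Properties
open import Data.List.Membership.Propositional using (_∈_)
open import Data.List.Membership.Propositional.Properties using (∈-map⁺; ∈-map⁻; ∈-upTo⁺; ∈-upTo⁻)
open import Data.List.Membership.Propositional.Properties.WithK using (unique∧set⇒bag)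
open import Data.List.Relation.Binary.BagAndSetEquality using (_∼[_]_; set; ∼bag⇒↭)
open import Data.List.Relation.Binary.Permutation.Propositional.Properties using (↭-length)
open import Data.List.Relation.Unary.All as All using (All)
open import Data.List.Relation.Unary.Unique.Propositional using (Unique)
import Data.List.Relation.Unary.Unique.Propositional.Properties as Unique
open import Data.Product using (Σ; _×_; ∃; _,_)
open import Data.Sum using (inj₁; inj₂)
open import Function using (_∘_; mk⇔)
open import Relation.Binary.Definitions using (tri<; tri≈; tri>)
open import Relation.Binary.PropositionalEquality
  using (_≡_; _≢_; refl; sym; trans; cong; cong₂; subst; module ≡-Reasoning)
open import Relation.Nullary using (contradiction)

data Rule : Set where
  mirror antimirror : Rule

other : Rule → Rule
other mirror     = antimirror
other antimirror = mirror

end : Rule → ℤ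
end mirror     = -1ℤ
end antimirror = 1ℤ

-- Both rules act on the middle ⟨a₁,…,a_{k-1}⟩; the outer entries are 1 and end r.
extend : Rule → List ℤ → List ℤ
extend mirror     M = (M ∷ʳ -1ℤ) ++ (-1ℤ ∷ reverse M)
extend antimirror M = M ++ (0ℤ ∷ map -_ (reverse M))

rule : ℕ → Rule
rule zero    = mirror
rule (suc k) = other (rule k)

middle : ℕ → List ℤ
middle zero    = []
middle (suc k) = extend (rule k) (middle k)

-- Pseq k is the paper's P_(k+1).
Pseq : ℕ → List ℤ
Pseq k = 1ℤ ∷ (middle k ∷ʳ end (rule k))

mirror-shape : ∀ M →
  (1ℤ ∷ (M ∷ʳ -1ℤ)) ++ reverse (1ℤ ∷ (M ∷ʳ -1ℤ)) ≡ 1ℤ ∷ (extend mirror M ∷ʳ 1ℤ)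
mirror-shape M = cong (1ℤ ∷_) (begin
  (M ∷ʳ -1ℤ) ++ reverse (1ℤ ∷ (M ∷ʳ -1ℤ))
    ≡⟨ cong ((M ∷ʳ -1ℤ) ++_) (unfold-reverse 1ℤ (M ∷ʳ -1ℤ)) ⟩
  (M ∷ʳ -1ℤ) ++ (reverse (M ∷ʳ -1ℤ) ∷ʳ 1ℤ)
    ≡⟨ cong (λ xs → (M ∷ʳ -1ℤ) ++ (xs ∷ʳ 1ℤ)) (reverse-++ M [ -1ℤ ]) ⟩
  (M ∷ʳ -1ℤ) ++ ((-1ℤ ∷ reverse M) ∷ʳ 1ℤ)
    ≡⟨ ++-assoc (M ∷ʳ -1ℤ) (-1ℤ ∷ reverse M) [ 1ℤ ] ⟨
  extend mirror M ∷ʳ 1ℤ ∎)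
  where open ≡-Reasoning

antimirror-shape : ∀ M →
  (1ℤ ∷ M) ++ (0ℤ ∷ map -_ (reverse (1ℤ ∷ M))) ≡ 1ℤ ∷ (extend antimirror M ∷ʳ -1ℤ)
antimirror-shape M = cong (1ℤ ∷_) (begin
  M ++ (0ℤ ∷ map -_ (reverse (1ℤ ∷ M)))
    ≡⟨ cong (λ xs → M ++ (0ℤ ∷ map -_ xs)) (unfold-reverse 1ℤ M) ⟩
  M ++ (0ℤ ∷ map -_ (reverse M ∷ʳ 1ℤ))
    ≡⟨ cong (λ xs → M ++ (0ℤ ∷ xs)) (map-++ -_ (reverse M) [ 1ℤ ]) ⟩
  M ++ ((0ℤ ∷ map -_ (reverse M)) ∷ʳ -1ℤ)
    ≡⟨ ++-assoc M (0ℤ ∷ map -_ (reverse M)) [ -1ℤ ] ⟨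
  extend antimirror M ∷ʳ -1ℤ ∎)
  where open ≡-Reasoning

isP-extend : ∀ r M → IsP (1ℤ ∷ (M ∷ʳ end r)) → IsP (1ℤ ∷ (extend r M ∷ʳ end (other r)))
isP-extend mirror     M p = subst IsP (mirror-shape M) (dbl p refl)
isP-extend antimirror M p = subst IsP (antimirror-shape M) (flip p refl)

isP-Pseq : ∀ k → IsP (Pseq k)
isP-Pseq zero    = base
isP-Pseq (suc k) = isP-extend (rule k) (middle k) (isP-Pseq k)

mirror-applies : ∀ r M → 1ℤ ≡ - end r →
  (1ℤ ∷ (M ∷ʳ end r)) ++ reverse (1ℤ ∷ (M ∷ʳ end r)) ≡ 1ℤ ∷ (extend r M ∷ʳ end (other r))
mirror-applies mirror M _ = mirror-shape M

antimirror-applies : ∀ r M → 1ℤ ≡ end r →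
  (1ℤ ∷ M) ++ (0ℤ ∷ map -_ (reverse (1ℤ ∷ M))) ≡ 1ℤ ∷ (extend r M ∷ʳ end (other r))
antimirror-applies antimirror M _ = antimirror-shape M

∷-∷ʳ-injective : ∀ {a b c d : ℤ} {xs ys} → a ∷ (xs ∷ʳ b) ≡ c ∷ (ys ∷ʳ d) → a ≡ c × xs ≡ ys × b ≡ d
∷-∷ʳ-injective {xs = xs} {ys} eq with refl , xs∷ʳb≡ys∷ʳd ← ∷-injective eq
  with refl , refl ← ∷ʳ-injective xs ys xs∷ʳb≡ys∷ʳd = refl , refl , refl

isP⇒≡Pseq : ∀ {t} → IsP t → ∃ λ k → t ≡ Pseq k
isP⇒≡Pseq base = zero , refl
isP⇒≡Pseq (dbl p a≡-b) with k , eq ← isP⇒≡Pseq p with refl , refl , refl ← ∷-∷ʳ-injective eq =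
  suc k , mirror-applies (rule k) (middle k) a≡-b
isP⇒≡Pseq (flip p a≡b) with k , eq ← isP⇒≡Pseq p with refl , refl , refl ← ∷-∷ʳ-injective eq =
  suc k , antimirror-applies (rule k) (middle k) a≡b

Symmetric : Rule → List ℤ → Set
Symmetric mirror     M = reverse M ≡ map -_ M
Symmetric antimirror M = reverse M ≡ M

map-neg-involutive : ∀ as → map -_ (map -_ as) ≡ as
map-neg-involutive as = trans (sym (map-∘ as)) (trans (map-cong ℤ.neg-involutive as) (map-id as))

extend-symmetric : ∀ r M → Symmetric (other r) (extend r M)
extend-symmetric mirror M = begin
  reverse ((M ∷ʳ -1ℤ) ++ (-1ℤ ∷ reverse M))
    ≡⟨ reverse-++ (M ∷ʳ -1ℤ) (-1ℤ ∷ reverse M) ⟩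
  reverse (-1ℤ ∷ reverse M) ++ reverse (M ∷ʳ -1ℤ)
    ≡⟨ cong₂ _++_ (unfold-reverse -1ℤ (reverse M)) (reverse-++ M [ -1ℤ ]) ⟩
  (reverse (reverse M) ∷ʳ -1ℤ) ++ (-1ℤ ∷ reverse M)
    ≡⟨ cong (λ xs → (xs ∷ʳ -1ℤ) ++ (-1ℤ ∷ reverse M)) (reverse-involutive M) ⟩
  (M ∷ʳ -1ℤ) ++ (-1ℤ ∷ reverse M) ∎
  where open ≡-Reasoning
extend-symmetric antimirror M = begin
  reverse (M ++ (0ℤ ∷ map -_ (reverse M)))
    ≡⟨ reverse-++ M _ ⟩
  reverse (0ℤ ∷ map -_ (reverse M)) ++ reverse M
    ≡⟨ cong (_++ reverse M) (unfold-reverse 0ℤ (map -_ (reverse M))) ⟩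
  (reverse (map -_ (reverse M)) ∷ʳ 0ℤ) ++ reverse M
    ≡⟨ cong (λ xs → (xs ∷ʳ 0ℤ) ++ reverse M) (reverse-map -_ (reverse M)) ⟨
  (map -_ (reverse (reverse M)) ∷ʳ 0ℤ) ++ reverse M
    ≡⟨ cong (λ xs → (map -_ xs ∷ʳ 0ℤ) ++ reverse M) (reverse-involutive M) ⟩
  (map -_ M ∷ʳ 0ℤ) ++ reverse M
    ≡⟨ ++-assoc (map -_ M) [ 0ℤ ] (reverse M) ⟩
  map -_ M ++ (0ℤ ∷ reverse M)
    ≡⟨ cong (λ xs → map -_ M ++ (0ℤ ∷ xs)) (map-neg-involutive (reverse M)) ⟨
  map -_ M ++ map -_ (0ℤ ∷ map -_ (reverse M))
    ≡⟨ map-++ -_ M _ ⟨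
  map -_ (M ++ (0ℤ ∷ map -_ (reverse M))) ∎
  where open ≡-Reasoning

middle-symmetric : ∀ k → Symmetric (rule k) (middle k)
middle-symmetric zero    = refl
middle-symmetric (suc k) = extend-symmetric (rule k) (middle k)

length-<-++-∷ : ∀ {A : Set} (xs : List A) y ys → length xs < length (xs ++ y ∷ ys)
length-<-++-∷ []       y ys = z<s
length-<-++-∷ (x ∷ xs) y ys = s<s (length-<-++-∷ xs y ys)

length-extend : ∀ r M → length M < length (extend r M)
length-extend mirror     M =
  ℕ.<-trans (length-<-++-∷ M -1ℤ []) (length-<-++-∷ (M ∷ʳ -1ℤ) -1ℤ (reverse M))
length-extend antimirror M = length-<-++-∷ M 0ℤ (map -_ (reverse M))

length-middle-< : ∀ {k j} → k < j → length (middle k) < length (middle j)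
length-middle-< {k} {suc j} (s≤s k≤j) with ℕ.m≤n⇒m<n∨m≡n k≤j
... | inj₁ k<j  = ℕ.<-trans (length-middle-< k<j) (length-extend (rule j) (middle j))
... | inj₂ refl = length-extend (rule k) (middle k)

length-Pseq : ∀ k → length (Pseq k) ≡ suc (length (middle k) ℕ.+ 1)
length-Pseq k = cong suc (length-++ (middle k))

length-Pseq-< : ∀ {k j} → k < j → length (Pseq k) < length (Pseq j)
length-Pseq-< {k} {j} k<j rewrite length-Pseq k | length-Pseq j =
  s<s (ℕ.+-monoˡ-< 1 (length-middle-< k<j))

length-Pseq-<⁻¹ : ∀ {k j} → length (Pseq k) < length (Pseq j) → k < j
length-Pseq-<⁻¹ {k} {j} lt with ℕ.<-cmp k j
... | tri< k<j _ _ = k<j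
... | tri≈ _ refl _ = contradiction lt (ℕ.<-irrefl refl)
... | tri> _ _ j<k = contradiction lt (ℕ.<-asym (length-Pseq-< j<k))

Pseq-injective : ∀ {k j} → Pseq k ≡ Pseq j → k ≡ j
Pseq-injective {k} {j} eq with ℕ.<-cmp k j
... | tri< k<j _ _ = contradiction (cong length eq) (ℕ.<⇒≢ (length-Pseq-< k<j))
... | tri≈ _ k≡j _ = k≡j
... | tri> _ _ j<k = contradiction (cong length eq) (ℕ.>⇒≢ (length-Pseq-< j<k))

Pseqs : ℕ → List (List ℤ)
Pseqs k = map Pseq (upTo k)

Pseqs-unique : ∀ k → Unique (Pseqs k)
Pseqs-unique k = Unique.map⁺ Pseq-injective (Unique.upTo⁺ k)

length-Pseqs : ∀ k → length (Pseqs k) ≡ k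
length-Pseqs k = trans (length-map Pseq (upTo k)) (length-upTo k)

∈-Pseqs⁻ : ∀ {k t} → t ∈ Pseqs k → IsP t × length t < length (Pseq k)
∈-Pseqs⁻ t∈ with j , j∈ , refl ← ∈-map⁻ Pseq t∈ = isP-Pseq j , length-Pseq-< (∈-upTo⁻ j∈)

∈-Pseqs⁺ : ∀ {k t} → IsP t → length t < length (Pseq k) → t ∈ Pseqs k
∈-Pseqs⁺ isP lt with j , refl ← isP⇒≡Pseq isP = ∈-map⁺ Pseq (∈-upTo⁺ (length-Pseq-<⁻¹ {j} lt))

Pseq-isNthP : ∀ k → IsNthP (suc k) (Pseq k)
Pseq-isNthP k =
  isP-Pseq k , Pseqs k , cong suc (length-Pseqs k) , Pseqs-unique k ,
  All.tabulate ∈-Pseqs⁻ , λ _ → ∈-Pseqs⁺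

-- The shorter P-sequences listed in IsNthP are exactly those in Pseqs, so their number fixes the index.
isNthP⇒≡Pseq : ∀ {k s} → IsNthP (suc k) s → s ≡ Pseq k
isNthP⇒≡Pseq (isP , L , 1+|L|≡1+k , L-unique , L-shorter , L-complete)
  with j , refl ← isP⇒≡Pseq isP = cong Pseq (ℕ.suc-injective (trans (cong suc j≡|L|) 1+|L|≡1+k))
  where
  L∼Pseqs : L ∼[ set ] Pseqs j
  L∼Pseqs = mk⇔ (λ t∈L → let isP , lt = All.lookup L-shorter t∈L in ∈-Pseqs⁺ isP lt)
                (λ t∈ → let isP , lt = ∈-Pseqs⁻ t∈ in L-complete _ isP lt)
  j≡|L| : j ≡ length L
  j≡|L| = sym (trans (↭-length (∼bag⇒↭ (unique∧set⇒bag L-unique (Pseqs-unique j) L∼Pseqs)))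
                     (length-Pseqs j))

dot : List ℤ → (ℕ → ℤ) → ℤ
dot []       φ = 0ℤ
dot (a ∷ as) φ = a * φ 0 + dot as (φ ∘ suc)

power : ℕ → ℕ → ℤ
power t i = + (i ^ t)

moment≡dot : ∀ t as → moment t as ≡ dot as (power t)
moment≡dot t as = moment-applyUpTo (λ i → i) as
  where
  moment-applyUpTo : ∀ g as →
    foldr _+_ 0ℤ (zipWith (λ i a → a * + (i ^ t)) (applyUpTo g (length as)) as) ≡ dot as (power t ∘ g)
  moment-applyUpTo g []       = refl
  moment-applyUpTo g (a ∷ as) = cong (_+_ (a * power t (g 0))) (moment-applyUpTo (g ∘ suc) as)

dot-sub : ∀ as φ χ → dot as (λ i → φ i - χ i) ≡ dot as φ - dot as χ
dot-sub []       φ χ = refl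
dot-sub (a ∷ as) φ χ =
  trans (cong (_+_ (a * (φ 0 - χ 0))) (dot-sub as (φ ∘ suc) (χ ∘ suc))) (distrib a (φ 0) (χ 0) _ _)
  where
  distrib : ∀ a x y A B → a * (x - y) + (A - B) ≡ (a * x + A) - (a * y + B)
  distrib = solve-∀

dot-++ : ∀ as bs φ → dot (as ++ bs) φ ≡ dot as φ + dot bs (φ ∘ (length as ℕ.+_))
dot-++ []       bs φ = sym (ℤ.+-identityˡ _)
dot-++ (a ∷ as) bs φ =
  trans (cong (_+_ (a * φ 0)) (dot-++ as bs (φ ∘ suc))) (sym (ℤ.+-assoc (a * φ 0) _ _))

dot-neg : ∀ as φ → dot (map -_ as) φ ≡ - dot as φ
dot-neg []       φ = refl
dot-neg (a ∷ as) φ = trans (cong (_+_ (- a * φ 0)) (dot-neg as (φ ∘ suc))) (neg-distrib a (φ 0) _)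
  where
  neg-distrib : ∀ a x A → - a * x + - A ≡ - (a * x + A)
  neg-distrib = solve-∀

dot-++-neg : ∀ as φ → dot (as ++ map -_ as) φ ≡ dot as φ - dot as (φ ∘ (length as ℕ.+_))
dot-++-neg as φ = trans (dot-++ as (map -_ as) φ) (cong (_+_ (dot as φ)) (dot-neg as _))

-- The negated copy is shifted by one less than the length, so the two copies of a meet at the 0.
dot-overlap-neg : ∀ a M φ →
  dot ((a ∷ M) ++ (0ℤ ∷ map -_ (M ∷ʳ a))) φ
    ≡ dot (a ∷ (M ∷ʳ a)) φ - dot (a ∷ (M ∷ʳ a)) (φ ∘ (suc (length M) ℕ.+_))
dot-overlap-neg a M φ = begin
  dot ((a ∷ M) ++ (0ℤ ∷ map -_ (M ∷ʳ a))) φ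
    ≡⟨ dot-++ (a ∷ M) _ φ ⟩
  dot (a ∷ M) φ + (0ℤ * φ (L ℕ.+ 0) + dot (map -_ (M ∷ʳ a)) ψ)
    ≡⟨ cong (λ x → dot (a ∷ M) φ + (0ℤ * φ (L ℕ.+ 0) + x)) (dot-neg (M ∷ʳ a) ψ) ⟩
  dot (a ∷ M) φ + (0ℤ * φ (L ℕ.+ 0) + - dot (M ∷ʳ a) ψ)
    ≡⟨ regroup (dot (a ∷ M) φ) (φ (L ℕ.+ 0)) (dot (M ∷ʳ a) ψ) a ⟩
  (dot (a ∷ M) φ + (a * φ (L ℕ.+ 0) + 0ℤ)) - (a * φ (L ℕ.+ 0) + dot (M ∷ʳ a) ψ)
    ≡⟨ cong (_- dot (a ∷ (M ∷ʳ a)) (φ ∘ (L ℕ.+_))) (dot-++ (a ∷ M) [ a ] φ) ⟨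
  dot (a ∷ (M ∷ʳ a)) φ - dot (a ∷ (M ∷ʳ a)) (φ ∘ (L ℕ.+_)) ∎
  where
  open ≡-Reasoning
  L = suc (length M)
  ψ = λ i → φ (L ℕ.+ suc i)
  regroup : ∀ A X B a → A + (0ℤ * X + - B) ≡ (A + (a * X + 0ℤ)) - (a * X + B)
  regroup = solve-∀

offset : Rule → List ℤ → ℕ
offset mirror     M = length (1ℤ ∷ (M ∷ʳ -1ℤ))
offset antimirror M = suc (length M)

-offset≢0 : ∀ r M → - (+ offset r M) ≢ 0ℤ
-offset≢0 mirror     M ()
-offset≢0 antimirror M ()

-- Symmetry turns the appended reversed copy into a negated copy of the sequence.
dot-extend : ∀ r M φ → Symmetric r M →
  dot (1ℤ ∷ (extend r M ∷ʳ end (other r))) φ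
    ≡ dot (1ℤ ∷ (M ∷ʳ end r)) φ - dot (1ℤ ∷ (M ∷ʳ end r)) (φ ∘ (offset r M ℕ.+_))
dot-extend mirror M φ rev≡neg =
  trans (cong (λ as → dot as φ) negated-copy) (dot-++-neg (1ℤ ∷ (M ∷ʳ -1ℤ)) φ)
  where
  open ≡-Reasoning
  negated-copy : 1ℤ ∷ (extend mirror M ∷ʳ 1ℤ) ≡ (1ℤ ∷ (M ∷ʳ -1ℤ)) ++ map -_ (1ℤ ∷ (M ∷ʳ -1ℤ))
  negated-copy = cong (1ℤ ∷_) (begin
    ((M ∷ʳ -1ℤ) ++ (-1ℤ ∷ reverse M)) ∷ʳ 1ℤ
      ≡⟨ ++-assoc (M ∷ʳ -1ℤ) (-1ℤ ∷ reverse M) [ 1ℤ ] ⟩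
    (M ∷ʳ -1ℤ) ++ (-1ℤ ∷ (reverse M ∷ʳ 1ℤ))
      ≡⟨ cong (λ xs → (M ∷ʳ -1ℤ) ++ (-1ℤ ∷ (xs ∷ʳ 1ℤ))) rev≡neg ⟩
    (M ∷ʳ -1ℤ) ++ (-1ℤ ∷ (map -_ M ∷ʳ 1ℤ))
      ≡⟨ cong (λ xs → (M ∷ʳ -1ℤ) ++ (-1ℤ ∷ xs)) (map-++ -_ M [ -1ℤ ]) ⟨
    (M ∷ʳ -1ℤ) ++ (-1ℤ ∷ map -_ (M ∷ʳ -1ℤ)) ∎)
dot-extend antimirror M φ rev≡id =
  trans (cong (λ as → dot as φ) negated-copy) (dot-overlap-neg 1ℤ M φ)
  where
  open ≡-Reasoning
  negated-copy : 1ℤ ∷ (extend antimirror M ∷ʳ -1ℤ) ≡ (1ℤ ∷ M) ++ (0ℤ ∷ map -_ (M ∷ʳ 1ℤ))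
  negated-copy = cong (1ℤ ∷_) (begin
    (M ++ (0ℤ ∷ map -_ (reverse M))) ∷ʳ -1ℤ
      ≡⟨ ++-assoc M (0ℤ ∷ map -_ (reverse M)) [ -1ℤ ] ⟩
    M ++ (0ℤ ∷ (map -_ (reverse M) ∷ʳ -1ℤ))
      ≡⟨ cong (λ xs → M ++ (0ℤ ∷ (map -_ xs ∷ʳ -1ℤ))) rev≡id ⟩
    M ++ (0ℤ ∷ (map -_ M ∷ʳ -1ℤ))
      ≡⟨ cong (λ xs → M ++ (0ℤ ∷ xs)) (map-++ -_ M [ 1ℤ ]) ⟨
    M ++ (0ℤ ∷ map -_ (M ∷ʳ 1ℤ)) ∎)

gap : ℕ → ℕ
gap k = offset (rule k) (middle k)

dot-Pseq-suc : ∀ k φ → dot (Pseq (suc k)) φ ≡ dot (Pseq k) (λ i → φ i - φ (gap k ℕ.+ i))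
dot-Pseq-suc k φ = trans (dot-extend (rule k) (middle k) φ (middle-symmetric k))
                         (sym (dot-sub (Pseq k) φ (φ ∘ (gap k ℕ.+_))))

Δ : ℕ → (ℕ → ℤ) → ℕ → ℤ
Δ zero    φ i = φ i
Δ (suc d) φ i = Δ d φ (suc i) - Δ d φ i

Δ-cong : ∀ d {φ χ} → (∀ i → φ i ≡ χ i) → ∀ i → Δ d φ i ≡ Δ d χ i
Δ-cong zero    φ≗χ i = φ≗χ i
Δ-cong (suc d) φ≗χ i = cong₂ _-_ (Δ-cong d φ≗χ (suc i)) (Δ-cong d φ≗χ i)

Δ-sub : ∀ d φ χ i → Δ d (λ j → φ j - χ j) i ≡ Δ d φ i - Δ d χ i
Δ-sub zero    φ χ i = refl
Δ-sub (suc d) φ χ i =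
  trans (cong₂ _-_ (Δ-sub d φ χ (suc i)) (Δ-sub d φ χ i))
        (interchange (Δ d φ (suc i)) (Δ d χ (suc i)) (Δ d φ i) (Δ d χ i))
  where
  interchange : ∀ a b c e → (a - b) - (c - e) ≡ (a - c) - (b - e)
  interchange = solve-∀

Δ-shift : ∀ d L φ i → Δ d (φ ∘ (L ℕ.+_)) i ≡ Δ d φ (L ℕ.+ i)
Δ-shift zero    L φ i = refl
Δ-shift (suc d) L φ i =
  cong₂ _-_ (trans (Δ-shift d L φ (suc i)) (cong (Δ d φ) (ℕ.+-suc L i))) (Δ-shift d L φ i)

Δ-const⇒Δ-zero : ∀ {d e φ c} → (∀ i → Δ d φ i ≡ c) → d < e → ∀ i → Δ e φ i ≡ 0ℤ
Δ-const⇒Δ-zero {d} {suc e} {c = c} Δφ≡c (s≤s d≤e) i with ℕ.m≤n⇒m<n∨m≡n d≤e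
... | inj₁ d<e  = cong₂ _-_ (Δ-const⇒Δ-zero Δφ≡c d<e (suc i)) (Δ-const⇒Δ-zero Δφ≡c d<e i)
... | inj₂ refl = trans (cong₂ _-_ (Δφ≡c (suc i)) (Δφ≡c i)) (ℤ.+-inverseʳ c)

telescope : ∀ (χ : ℕ → ℤ) c → (∀ i → χ (suc i) - χ i ≡ c) → ∀ L i → χ i - χ (L ℕ.+ i) ≡ - (+ L) * c
telescope χ c Δχ≡c zero    i = cancel (χ i) c
  where
  cancel : ∀ a c → a - a ≡ - (+ 0) * c
  cancel = solve-∀
telescope χ c Δχ≡c (suc L) i = begin
  χ i - χ (suc L ℕ.+ i)
    ≡⟨ split (χ i) (χ (L ℕ.+ i)) _ ⟩
  (χ i - χ (L ℕ.+ i)) - (χ (suc (L ℕ.+ i)) - χ (L ℕ.+ i))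
    ≡⟨ cong₂ _-_ (telescope χ c Δχ≡c L i) (Δχ≡c (L ℕ.+ i)) ⟩
  - (+ L) * c - c
    ≡⟨ collect (+ L) c ⟩
  - (1ℤ + + L) * c
    ≡⟨ cong (λ x → - x * c) (ℤ.pos-+ 1 L) ⟨
  - (+ suc L) * c ∎
  where
  open ≡-Reasoning
  split : ∀ x y z → x - z ≡ (x - y) - (z - y)
  split = solve-∀
  collect : ∀ l c → - l * c - c ≡ - (1ℤ + l) * c
  collect = solve-∀

Δ-leibniz : ∀ n φ i →
  Δ (suc n) (λ j → + j * φ j) i ≡ + i * Δ (suc n) φ i + + suc n * Δ n φ (suc i)
Δ-leibniz zero    φ i = base-case (+ i) (φ (suc i)) (φ i)
  where
  base-case : ∀ x b a → (1ℤ + x) * b - x * a ≡ x * (b - a) + 1ℤ * b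
  base-case = solve-∀
Δ-leibniz (suc n) φ i =
  trans (cong₂ _-_ (Δ-leibniz n φ (suc i)) (Δ-leibniz n φ i))
        (regroup (+ i) (+ suc n) (Δ (suc n) φ i) (Δ n φ (suc (suc i))) (Δ n φ (suc i)))
  where
  regroup : ∀ x m A B₂ B₁ →
    ((1ℤ + x) * (B₂ - B₁) + m * B₂) - (x * A + m * B₁) ≡ x * ((B₂ - B₁) - A) + (1ℤ + m) * (B₂ - B₁)
  regroup = solve-∀

Δ-power : ∀ t i → Δ t (power t) i ≡ + (t !)
Δ-power zero    i = refl
Δ-power (suc t) i = begin
  Δ (suc t) (power (suc t)) i
    ≡⟨ Δ-cong (suc t) (λ j → ℤ.pos-* j (j ^ t)) i ⟩
  Δ (suc t) (λ j → + j * power t j) i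
    ≡⟨ Δ-leibniz t (power t) i ⟩
  + i * (Δ t (power t) (suc i) - Δ t (power t) i) + + suc t * Δ t (power t) (suc i)
    ≡⟨ cong₂ (λ a b → + i * (a - b) + + suc t * a) (Δ-power t (suc i)) (Δ-power t i) ⟩
  + i * (+ (t !) - + (t !)) + + suc t * + (t !)
    ≡⟨ drop (+ i) (+ (t !)) (+ suc t) ⟩
  + suc t * + (t !)
    ≡⟨ ℤ.pos-* (suc t) (t !) ⟨
  + (suc t !) ∎
  where
  open ≡-Reasoning
  drop : ∀ x F s → x * (F - F) + s * F ≡ s * F
  drop = solve-∀

scale : ℕ → ℤ
scale zero    = -1ℤ
scale (suc k) = - (+ gap k) * scale k

scale-nonzero : ∀ k → scale k ≢ 0ℤ
scale-nonzero zero    ()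
scale-nonzero (suc k) eq with ℤ.i*j≡0⇒i≡0∨j≡0 (- (+ gap k)) eq
... | inj₁ -gap≡0  = -offset≢0 (rule k) (middle k) -gap≡0
... | inj₂ scale≡0 = scale-nonzero k scale≡0

dot-Pseq : ∀ k φ c → (∀ i → Δ (suc k) φ i ≡ c) → dot (Pseq k) φ ≡ c * scale k
dot-Pseq zero    φ c Δφ≡c = trans (rearrange (φ 0) (φ 1)) (cong (_* -1ℤ) (Δφ≡c 0))
  where
  rearrange : ∀ a b → 1ℤ * a + (-1ℤ * b + 0ℤ) ≡ (b - a) * -1ℤ
  rearrange = solve-∀
dot-Pseq (suc k) φ c Δφ≡c = begin
  dot (Pseq (suc k)) φ                       ≡⟨ dot-Pseq-suc k φ ⟩
  dot (Pseq k) (λ i → φ i - φ (gap k ℕ.+ i)) ≡⟨ dot-Pseq k _ _ Δ-shifted-difference ⟩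
  (- (+ gap k) * c) * scale k                ≡⟨ rearrange (+ gap k) c (scale k) ⟩
  c * scale (suc k)                          ∎
  where
  open ≡-Reasoning
  rearrange : ∀ l c s → (- l * c) * s ≡ c * (- l * s)
  rearrange = solve-∀
  Δ-shifted-difference : ∀ i → Δ (suc k) (λ i → φ i - φ (gap k ℕ.+ i)) i ≡ - (+ gap k) * c
  Δ-shifted-difference i = begin
    Δ (suc k) (λ i → φ i - φ (gap k ℕ.+ i)) i
      ≡⟨ Δ-sub (suc k) φ (φ ∘ (gap k ℕ.+_)) i ⟩
    Δ (suc k) φ i - Δ (suc k) (φ ∘ (gap k ℕ.+_)) i
      ≡⟨ cong (_-_ (Δ (suc k) φ i)) (Δ-shift (suc k) (gap k) φ i) ⟩
    Δ (suc k) φ i - Δ (suc k) φ (gap k ℕ.+ i)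
      ≡⟨ telescope (Δ (suc k) φ) c Δφ≡c (gap k) i ⟩
    - (+ gap k) * c ∎

moment-Pseq-< : ∀ k t → t < suc k → moment t (Pseq k) ≡ 0ℤ
moment-Pseq-< k t t<1+k = begin
  moment t (Pseq k)      ≡⟨ moment≡dot t (Pseq k) ⟩
  dot (Pseq k) (power t) ≡⟨ dot-Pseq k (power t) 0ℤ (Δ-const⇒Δ-zero (Δ-power t) t<1+k) ⟩
  0ℤ * scale k           ≡⟨ ℤ.*-zeroˡ (scale k) ⟩
  0ℤ                     ∎
  where open ≡-Reasoning

moment-Pseq-suc : ∀ k → moment (suc k) (Pseq k) ≡ + (suc k !) * scale k
moment-Pseq-suc k =
  trans (moment≡dot (suc k) (Pseq k)) (dot-Pseq k (power (suc k)) _ (Δ-power (suc k)))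

moment-Pseq-≢0 : ∀ k → moment (suc k) (Pseq k) ≢ 0ℤ
moment-Pseq-≢0 k eq with ℤ.i*j≡0⇒i≡0∨j≡0 (+ (suc k !)) (trans (sym (moment-Pseq-suc k)) eq)
... | inj₁ factorial≡0 = ℕ.<-irrefl (sym (ℤ.+-injective factorial≡0)) (ℕ.1≤n! (suc k))
... | inj₂ scale≡0     = scale-nonzero k scale≡0

corollary1 : (n : ℕ) → n ≥ 1 →
    (Σ (List ℤ) λ s → IsNthP n s) ×
    (∀ s → IsNthP n s →
      (∀ t → t < n → moment t s ≡ 0ℤ) × (moment n s ≢ 0ℤ))
corollary1 (suc k) _ = (Pseq k , Pseq-isNthP k) , moments
  where
  moments : ∀ s → IsNthP (suc k) s → (∀ t → t < suc k → moment t s ≡ 0ℤ) × (moment (suc k) s ≢ 0ℤ)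
  moments s nth with refl ← isNthP⇒≡Pseq nth = moment-Pseq-< k , moment-Pseq-≢0 k
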